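{- Let $\mathbf{D}$ be a dagger kernel category. Then its dagger Karoubi envelope $\mathrm{Kar}^\dagger(\mathbf{D})$ is again a dagger kernel category. Moreover, the embedding $\mathcal{I}\colon \mathbf{D}\to\mathrm{Kar}^\dagger(\mathbf{D})$, $X\mapsto (X,\mathrm{id}_X)$, $f\mapsto f$, is a map of dagger kernel categories.
   Context: A dagger category is a category $\mathbf{D}$ with a functor $\dagger\colon\mathbf{D}^{\mathrm{op}}\to\mathbf{D}$ that is the identity on objects and satisfies $f^{\dagger\dagger}=f$. A dagger mono is a map $k$ with $k^\dagger\circ k=\mathrm{id}$. A dagger kernel category is a dagger category with a zero object $0$ (yielding zero maps $X\to 0\to Y$) in which every morphism has a kernel that can be chosen to be a dagger mono. A map of dagger kernel categories is a functor preserving the dagger, the zero object and (dagger) kernels. The dagger Karoubi envelope $\mathrm{Kar}^\dagger(\mathbf{D})$ has as objects pairs $(X,s)$ with $s\colon X\to X$ a self-adjoint idempotent ($s^\dagger=s=s\circ s$); a morphism $f\colon (X,s)\to(Y,t)$ is a map $f\colon X\to Y$ of $\mathbf{D}$ with $f\circ s=f=t\circ f$; the identity on $(X,s)$ is $s$, composition and dagger are as in $\mathbf{D}$. -}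

module Defs where

open import Level using (Level; _⊔_) renaming (suc to lsuc)
open import Data.Product using (Σ; _×_; _,_; proj₁; proj₂)
open import Relation.Binary using (Rel; IsEquivalence; Setoid)
import Relation.Binary.Reasoning.Setoid as SetoidR

record Category (o ℓ e : Level) : Set (lsuc (o ⊔ ℓ ⊔ e)) where
  infixr 9 _∘_
  infix  4 _≈_
  field
    Obj       : Set o
    _⇒_       : Obj → Obj → Set ℓ
    _≈_       : ∀ {A B} → Rel (A ⇒ B) e
    id        : ∀ {A} → A ⇒ A
    _∘_       : ∀ {A B C} → B ⇒ C → A ⇒ B → A ⇒ C
    equiv     : ∀ {A B} → IsEquivalence (_≈_ {A} {B})
    ∘-resp-≈  : ∀ {A B C} {f h : B ⇒ C} {g i : A ⇒ B} →
                f ≈ h → g ≈ i → f ∘ g ≈ h ∘ i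
    assoc     : ∀ {A B C D} {f : A ⇒ B} {g : B ⇒ C} {h : C ⇒ D} →
                (h ∘ g) ∘ f ≈ h ∘ (g ∘ f)
    identityˡ : ∀ {A B} {f : A ⇒ B} → id ∘ f ≈ f
    identityʳ : ∀ {A B} {f : A ⇒ B} → f ∘ id ≈ f

  hom-setoid : ∀ {A B} → Setoid ℓ e
  hom-setoid {A} {B} = record { Carrier = A ⇒ B ; _≈_ = _≈_ ; isEquivalence = equiv }

  module Eq {A B} = IsEquivalence (equiv {A} {B})

module _ {o ℓ e} (C : Category o ℓ e) where
  open Category C

  IsZeroObject : Obj → Set (o ⊔ ℓ ⊔ e)
  IsZeroObject Z = ∀ X →
    (Σ (Z ⇒ X) λ u → ∀ (g : Z ⇒ X) → g ≈ u) ×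
    (Σ (X ⇒ Z) λ u → ∀ (g : X ⇒ Z) → g ≈ u)

  record ZeroObject : Set (o ⊔ ℓ ⊔ e) where
    field
      𝟘      : Obj
      isZero : IsZeroObject 𝟘

    zeroMap : ∀ X Y → X ⇒ Y
    zeroMap X Y = proj₁ (proj₁ (isZero Y)) ∘ proj₁ (proj₂ (isZero X))

  IsKernel : (z : ZeroObject) → ∀ {X Y K} → X ⇒ Y → K ⇒ X → Set (o ⊔ ℓ ⊔ e)
  IsKernel z {X} {Y} {K} f k =
    (f ∘ k ≈ ZeroObject.zeroMap z K Y) ×
    (∀ {Z} (g : Z ⇒ X) → f ∘ g ≈ ZeroObject.zeroMap z Z Y →
       Σ (Z ⇒ K) λ h → (k ∘ h ≈ g) × (∀ (h' : Z ⇒ K) → k ∘ h' ≈ g → h' ≈ h))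

  record Kernel (z : ZeroObject) {X Y} (f : X ⇒ Y) : Set (o ⊔ ℓ ⊔ e) where
    field
      K        : Obj
      k        : K ⇒ X
      isKernel : IsKernel z f k

record DaggerCategory (o ℓ e : Level) : Set (lsuc (o ⊔ ℓ ⊔ e)) where
  field
    cat : Category o ℓ e
  open Category cat
  infix 10 _†
  field
    _†             : ∀ {A B} → A ⇒ B → B ⇒ A
    †-resp-≈       : ∀ {A B} {f g : A ⇒ B} → f ≈ g → f † ≈ g †
    †-identity     : ∀ {A} → (id {A}) † ≈ id
    †-homomorphism : ∀ {A B C} {f : A ⇒ B} {g : B ⇒ C} → (g ∘ f) † ≈ f † ∘ g †
    †-involutive   : ∀ {A B} {f : A ⇒ B} → (f †) † ≈ f

  IsDaggerMono : ∀ {A B} → A ⇒ B → Set e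
  IsDaggerMono k = k † ∘ k ≈ id

record IsDaggerKernelCategory {o ℓ e} (D : DaggerCategory o ℓ e) : Set (o ⊔ ℓ ⊔ e) where
  open DaggerCategory D
  field
    zeroObj : ZeroObject cat
    kernel  : ∀ {X Y} (f : Category._⇒_ cat X Y) → Kernel cat zeroObj f
    kernel-dagger-mono : ∀ {X Y} (f : Category._⇒_ cat X Y) →
                         IsDaggerMono (Kernel.k (kernel f))

record Functor {o ℓ e o' ℓ' e'} (C : Category o ℓ e) (D : Category o' ℓ' e')
       : Set (o ⊔ ℓ ⊔ e ⊔ o' ⊔ ℓ' ⊔ e') where
  private
    module C = Category C
    module D = Category D
  field
    F₀           : C.Obj → D.Obj
    F₁           : ∀ {A B} → A C.⇒ B → F₀ A D.⇒ F₀ B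
    identity     : ∀ {A} → F₁ (C.id {A}) D.≈ D.id
    homomorphism : ∀ {A B C'} {f : A C.⇒ B} {g : B C.⇒ C'} →
                   F₁ (g C.∘ f) D.≈ F₁ g D.∘ F₁ f
    F-resp-≈     : ∀ {A B} {f g : A C.⇒ B} → f C.≈ g → F₁ f D.≈ F₁ g

record IsDaggerKernelMap {o ℓ e o' ℓ' e'}
       {D : DaggerCategory o ℓ e} {E : DaggerCategory o' ℓ' e'}
       (DK : IsDaggerKernelCategory D) (EK : IsDaggerKernelCategory E)
       (F : Functor (DaggerCategory.cat D) (DaggerCategory.cat E))
       : Set (o ⊔ ℓ ⊔ e ⊔ o' ⊔ ℓ' ⊔ e') where
  private
    module D = DaggerCategory D
    module E = DaggerCategory E
    module DC = Category D.cat
    module EC = Category E.cat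
    open Functor F
  field
    preserves-†      : ∀ {A B} (f : A DC.⇒ B) → F₁ (f D.†) EC.≈ (F₁ f) E.†
    preserves-zero   : IsZeroObject E.cat
                         (F₀ (ZeroObject.𝟘 (IsDaggerKernelCategory.zeroObj DK)))
    preserves-kernel : ∀ {X Y K} (f : X DC.⇒ Y) (k : K DC.⇒ X) →
                       IsKernel D.cat (IsDaggerKernelCategory.zeroObj DK) f k →
                       IsKernel E.cat (IsDaggerKernelCategory.zeroObj EK) (F₁ f) (F₁ k)

module Karoubi {o ℓ e} (D : DaggerCategory o ℓ e) where
  open DaggerCategory D
  open Category cat

  record KObj : Set (o ⊔ ℓ ⊔ e) where
    constructor kobj
    field
      X      : Obj
      s      : X ⇒ X
      s-sa   : s † ≈ s
      s-idem : s ∘ s ≈ s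

  open KObj

  record KHom (A B : KObj) : Set (ℓ ⊔ e) where
    constructor khom
    field
      map  : X A ⇒ X B
      pre  : map ∘ s A ≈ map
      post : s B ∘ map ≈ map

  open KHom

  private
    module R {A B} = SetoidR (hom-setoid {A} {B})

  kid : ∀ {A} → KHom A A
  kid {A} = khom (s A) (s-idem A) (s-idem A)

  _k∘_ : ∀ {A B C} → KHom B C → KHom A B → KHom A C
  _k∘_ {A} {B} {C} g f = khom (map g ∘ map f) p q
    where
      open R
      p : (map g ∘ map f) ∘ s A ≈ map g ∘ map f
      p = begin
        (map g ∘ map f) ∘ s A ≈⟨ assoc ⟩
        map g ∘ (map f ∘ s A) ≈⟨ ∘-resp-≈ Eq.refl (pre f) ⟩
        map g ∘ map f ∎
      q : s C ∘ (map g ∘ map f) ≈ map g ∘ map f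
      q = begin
        s C ∘ (map g ∘ map f) ≈⟨ Eq.sym assoc ⟩
        (s C ∘ map g) ∘ map f ≈⟨ ∘-resp-≈ (post g) Eq.refl ⟩
        map g ∘ map f ∎

  kcat : Category (o ⊔ ℓ ⊔ e) (ℓ ⊔ e) e
  kcat = record
    { Obj = KObj
    ; _⇒_ = KHom
    ; _≈_ = λ f g → map f ≈ map g
    ; id = kid
    ; _∘_ = _k∘_
    ; equiv = record { refl = Eq.refl ; sym = Eq.sym ; trans = Eq.trans }
    ; ∘-resp-≈ = ∘-resp-≈
    ; assoc = assoc
    ; identityˡ = λ {A} {B} {f} → post f
    ; identityʳ = λ {A} {B} {f} → pre f
    }

  k† : ∀ {A B} → KHom A B → KHom B A
  k† {A} {B} f = khom (map f †) p q
    where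
      open R
      p : map f † ∘ s B ≈ map f †
      p = begin
        map f † ∘ s B   ≈⟨ ∘-resp-≈ Eq.refl (Eq.sym (s-sa B)) ⟩
        map f † ∘ s B † ≈⟨ Eq.sym †-homomorphism ⟩
        (s B ∘ map f) † ≈⟨ †-resp-≈ (post f) ⟩
        map f † ∎
      q : s A ∘ map f † ≈ map f †
      q = begin
        s A ∘ map f †   ≈⟨ ∘-resp-≈ (Eq.sym (s-sa A)) Eq.refl ⟩
        s A † ∘ map f † ≈⟨ Eq.sym †-homomorphism ⟩
        (map f ∘ s A) † ≈⟨ †-resp-≈ (pre f) ⟩
        map f † ∎

  Kar : DaggerCategory (o ⊔ ℓ ⊔ e) (ℓ ⊔ e) e
  Kar = record
    { cat = kcat
    ; _† = k†
    ; †-resp-≈ = †-resp-≈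
    ; †-identity = λ {A} → s-sa A
    ; †-homomorphism = †-homomorphism
    ; †-involutive = †-involutive
    }

  I : Functor cat kcat
  I = record
    { F₀ = λ X → kobj X id †-identity identityˡ
    ; F₁ = λ f → khom f identityʳ identityˡ
    ; identity = Eq.refl
    ; homomorphism = Eq.refl
    ; F-resp-≈ = λ p → p
    }

module Submission where

-- Proof idea.  Write I for the embedding X ↦ (X , id) of D into Kar†(D).
--
-- If Z is a zero object of D then so is I Z in Kar†(D):
--   a map (X , s) → (Z , id) of Kar† is just a map X → Z of D, and
--   uniqueness is inherited.  The zero maps of Kar† are those of D.
--
-- Let f : (X , s) → (Y , t) and let k : K → X be a dagger-mono
--   kernel of f in D.  Since k is a dagger mono, k ∘ k† fixes every g with
--   f ∘ g = 0 (it projects onto the kernel).  Then r = k† ∘ s ∘ k is a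
--   self-adjoint idempotent on K and m = s ∘ k : (K , r) → (X , s) is a
--   dagger-mono kernel of f in Kar†; the mediating map for g is k† ∘ g.
--
-- * The embedding preserves the dagger on the nose, preserves the zero object
--   by the first point, and preserves kernels because a kernel k of f in D
--   is monic, which forces the D-mediator h of g : (Z , s) → I X to satisfy
--   h ∘ s = h, i.e. to be a morphism of Kar†.

open import Defs
open import Level using (Level)
open import Data.Product using (Σ; _,_; proj₁; proj₂)
import Relation.Binary.Reasoning.Setoid as SetoidR

module KernelFacts {o ℓ e} (C : Category o ℓ e) (z : ZeroObject C) where
  open Category C
  open ZeroObject z
  private
    module R {A B} = SetoidR (hom-setoid {A} {B})
  open R

  -- Precomposing a zero map gives a zero map (maps into 0 are unique).
  zeroMap-absorbʳ : ∀ {X Y W} (h : X ⇒ Y) → zeroMap Y W ∘ h ≈ zeroMap X W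
  zeroMap-absorbʳ {X} {Y} {W} h = begin
    (out ∘ into Y) ∘ h  ≈⟨ assoc ⟩
    out ∘ (into Y ∘ h)  ≈⟨ ∘-resp-≈ Eq.refl (proj₂ (proj₂ (isZero X)) (into Y ∘ h)) ⟩
    out ∘ into X        ∎
    where
      out = proj₁ (proj₁ (isZero W))
      into : ∀ V → V ⇒ 𝟘
      into V = proj₁ (proj₂ (isZero V))

  -- Kernels are monic: both h and h' mediate the map k ∘ h' into the kernel.
  kernel-monic : ∀ {X Y K Z} {f : X ⇒ Y} {k : K ⇒ X} → IsKernel C z f k →
                 {h h' : Z ⇒ K} → k ∘ h ≈ k ∘ h' → h ≈ h'
  kernel-monic {f = f} {k} (fk≈0 , universal) {h} {h'} kh≈kh' =
    Eq.trans (unique h kh≈kh') (Eq.sym (unique h' Eq.refl))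
    where
      f∘kh'≈0 : f ∘ (k ∘ h') ≈ zeroMap _ _
      f∘kh'≈0 = begin
        f ∘ (k ∘ h')       ≈⟨ Eq.sym assoc ⟩
        (f ∘ k) ∘ h'       ≈⟨ ∘-resp-≈ fk≈0 Eq.refl ⟩
        zeroMap _ _ ∘ h'   ≈⟨ zeroMap-absorbʳ h' ⟩
        zeroMap _ _        ∎
      unique = proj₂ (proj₂ (universal (k ∘ h') f∘kh'≈0))

module DaggerFacts {o ℓ e} (D : DaggerCategory o ℓ e) where
  open DaggerCategory D
  open Category cat
  private
    module R {A B} = SetoidR (hom-setoid {A} {B})
  open R

  conjugate-self-adjoint : ∀ {K X} {s : X ⇒ X} (k : K ⇒ X) →
                           s † ≈ s → (k † ∘ (s ∘ k)) † ≈ k † ∘ (s ∘ k)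
  conjugate-self-adjoint {s = s} k s-sa = begin
    (k † ∘ (s ∘ k)) †       ≈⟨ †-homomorphism ⟩
    (s ∘ k) † ∘ k † †       ≈⟨ ∘-resp-≈ †-homomorphism †-involutive ⟩
    (k † ∘ s †) ∘ k         ≈⟨ ∘-resp-≈ (∘-resp-≈ Eq.refl s-sa) Eq.refl ⟩
    (k † ∘ s) ∘ k           ≈⟨ assoc ⟩
    k † ∘ (s ∘ k)           ∎

  kernel-projection : (z : ZeroObject cat) → ∀ {X Y K Z} {f : X ⇒ Y} {k : K ⇒ X} →
                      IsKernel cat z f k → IsDaggerMono k →
                      (g : Z ⇒ X) → f ∘ g ≈ ZeroObject.zeroMap z Z Y →
                      k ∘ (k † ∘ g) ≈ g
  kernel-projection z {k = k} (_ , universal) k†k≈id g fg≈0 = begin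
    k ∘ (k † ∘ g)          ≈⟨ ∘-resp-≈ Eq.refl (∘-resp-≈ Eq.refl (Eq.sym kh≈g)) ⟩
    k ∘ (k † ∘ (k ∘ h))    ≈⟨ ∘-resp-≈ Eq.refl (Eq.sym assoc) ⟩
    k ∘ ((k † ∘ k) ∘ h)    ≈⟨ ∘-resp-≈ Eq.refl (∘-resp-≈ k†k≈id Eq.refl) ⟩
    k ∘ (id ∘ h)           ≈⟨ ∘-resp-≈ Eq.refl identityˡ ⟩
    k ∘ h                  ≈⟨ kh≈g ⟩
    g                      ∎
    where
      h = proj₁ (universal g fg≈0)
      kh≈g = proj₁ (proj₂ (universal g fg≈0))

module KaroubiKernels {o ℓ e} (D : DaggerCategory o ℓ e) where
  open DaggerCategory D
  open Category cat
  open Karoubi D using (KObj; kobj; KHom; khom; kcat; I)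
  open KObj
  open KHom
  open Functor I using (F₀; F₁)
  open DaggerFacts D
  private
    module R {A B} = SetoidR (hom-setoid {A} {B})
  open R

  embedding-preserves-zero : ∀ {Z} → IsZeroObject cat Z → IsZeroObject kcat (F₀ Z)
  embedding-preserves-zero isZ A =
    ( khom from-zero identityʳ (unique-from (s A ∘ from-zero)) , λ g → unique-from (map g) )
    , ( khom to-zero (unique-to (to-zero ∘ s A)) identityˡ , λ g → unique-to (map g) )
    where
      from-zero = proj₁ (proj₁ (isZ (X A)))
      unique-from = proj₂ (proj₁ (isZ (X A)))
      to-zero = proj₁ (proj₂ (isZ (X A)))
      unique-to = proj₂ (proj₂ (isZ (X A)))

  -- The zero object of Kar†(D) induced by one of D; its zero maps are
  -- (definitionally) the zero maps of D.
  karoubi-zero : ZeroObject cat → ZeroObject kcat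
  karoubi-zero z = record
    { 𝟘 = F₀ (ZeroObject.𝟘 z)
    ; isZero = embedding-preserves-zero (ZeroObject.isZero z)
    }

  -- A dagger-mono kernel k of map f in D yields a dagger-mono kernel of f
  -- in Kar†(D): the object (K , k† ∘ s ∘ k) with the map s ∘ k.
  module KernelFromD (z : ZeroObject cat) {A B : KObj} (f : KHom A B)
                     {K : Obj} (k : K ⇒ X A) (isK : IsKernel cat z (map f) k)
                     (k†k≈id : IsDaggerMono k) where
    open ZeroObject z using (zeroMap)

    m : K ⇒ X A
    m = s A ∘ k

    r : K ⇒ K
    r = k † ∘ m

    f∘m≈0 : map f ∘ m ≈ zeroMap K (X B)
    f∘m≈0 = begin
      map f ∘ (s A ∘ k)  ≈⟨ Eq.sym assoc ⟩
      (map f ∘ s A) ∘ k  ≈⟨ ∘-resp-≈ (pre f) Eq.refl ⟩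
      map f ∘ k          ≈⟨ proj₁ isK ⟩
      zeroMap K (X B)    ∎

    s∘m≈m : s A ∘ m ≈ m
    s∘m≈m = begin
      s A ∘ (s A ∘ k)    ≈⟨ Eq.sym assoc ⟩
      (s A ∘ s A) ∘ k    ≈⟨ ∘-resp-≈ (s-idem A) Eq.refl ⟩
      m                  ∎

    m-mediates : ∀ {Z} (g : Z ⇒ X A) → map f ∘ g ≈ zeroMap Z (X B) →
                 m ∘ (k † ∘ g) ≈ s A ∘ g
    m-mediates g fg≈0 = begin
      (s A ∘ k) ∘ (k † ∘ g)  ≈⟨ assoc ⟩
      s A ∘ (k ∘ (k † ∘ g))  ≈⟨ ∘-resp-≈ Eq.refl (kernel-projection z isK k†k≈id g fg≈0) ⟩
      s A ∘ g                ∎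

    m∘r≈m : m ∘ r ≈ m
    m∘r≈m = Eq.trans (m-mediates m f∘m≈0) s∘m≈m

    r-idem : r ∘ r ≈ r
    r-idem = Eq.trans assoc (∘-resp-≈ Eq.refl m∘r≈m)

    kernelObj : KObj
    kernelObj = kobj K r (conjugate-self-adjoint k (s-sa A)) r-idem

    kernelMap : KHom kernelObj A
    kernelMap = khom m m∘r≈m s∘m≈m

    -- m† ∘ m = r, the identity of kernelObj.
    kernelMap-dagger-mono : m † ∘ m ≈ r
    kernelMap-dagger-mono = begin
      (s A ∘ k) † ∘ m      ≈⟨ ∘-resp-≈ †-homomorphism Eq.refl ⟩
      (k † ∘ s A †) ∘ m    ≈⟨ ∘-resp-≈ (∘-resp-≈ Eq.refl (s-sa A)) Eq.refl ⟩
      (k † ∘ s A) ∘ m      ≈⟨ assoc ⟩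
      k † ∘ (s A ∘ m)      ≈⟨ ∘-resp-≈ Eq.refl s∘m≈m ⟩
      r                    ∎

    mediator : ∀ {Z} (g : KHom Z A) → map f ∘ map g ≈ zeroMap (X Z) (X B) →
               KHom Z kernelObj
    mediator {Z} g fg≈0 = khom (k † ∘ map g) pre-s post-r
      where
        pre-s : (k † ∘ map g) ∘ s Z ≈ k † ∘ map g
        pre-s = Eq.trans assoc (∘-resp-≈ Eq.refl (pre g))
        post-r : r ∘ (k † ∘ map g) ≈ k † ∘ map g
        post-r = begin
          (k † ∘ m) ∘ (k † ∘ map g)  ≈⟨ assoc ⟩
          k † ∘ (m ∘ (k † ∘ map g))  ≈⟨ ∘-resp-≈ Eq.refl (m-mediates (map g) fg≈0) ⟩
          k † ∘ (s A ∘ map g)        ≈⟨ ∘-resp-≈ Eq.refl (post g) ⟩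
          k † ∘ map g                ∎

    -- Any h' : Z → kernelObj with m ∘ h' = g equals k† ∘ g, as h' = r ∘ h'.
    mediator-unique : ∀ {Z} (g : KHom Z A) (h' : KHom Z kernelObj) →
                      m ∘ map h' ≈ map g → map h' ≈ k † ∘ map g
    mediator-unique g h' mh'≈g = begin
      map h'                 ≈⟨ Eq.sym (post h') ⟩
      (k † ∘ m) ∘ map h'     ≈⟨ assoc ⟩
      k † ∘ (m ∘ map h')     ≈⟨ ∘-resp-≈ Eq.refl mh'≈g ⟩
      k † ∘ map g            ∎

    isKernel : IsKernel kcat (karoubi-zero z) f kernelMap
    isKernel = f∘m≈0 , λ g fg≈0 →
      mediator g fg≈0 , Eq.trans (m-mediates (map g) fg≈0) (post g) , λ h' → mediator-unique g h'

  -- The embedding sends kernels in D to kernels in Kar†(D): the D-mediator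
  -- h of g : (Z , s) → I X is a Kar†-morphism because k ∘ (h ∘ s) = k ∘ h
  -- and kernels are monic.
  embedding-preserves-kernel : (z : ZeroObject cat) → ∀ {X Y K} (f : X ⇒ Y) (k : K ⇒ X) →
                               IsKernel cat z f k → IsKernel kcat (karoubi-zero z) (F₁ f) (F₁ k)
  embedding-preserves-kernel z f k isK@(fk≈0 , universal) = fk≈0 , λ {Z} g fg≈0 →
    let (h , kh≈g , unique) = universal (map g) fg≈0
        h∘s≈h : h ∘ s Z ≈ h
        h∘s≈h = KernelFacts.kernel-monic cat z isK (begin
          k ∘ (h ∘ s Z)   ≈⟨ Eq.sym assoc ⟩
          (k ∘ h) ∘ s Z   ≈⟨ ∘-resp-≈ kh≈g Eq.refl ⟩
          map g ∘ s Z     ≈⟨ pre g ⟩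
          map g           ≈⟨ Eq.sym kh≈g ⟩
          k ∘ h           ∎)
    in khom h h∘s≈h identityˡ , kh≈g , λ h' → unique (map h')

proposition2p1 : ∀ {o ℓ e : Level} (D : DaggerCategory o ℓ e) →
    (DK : IsDaggerKernelCategory D) →
    Σ (IsDaggerKernelCategory (Karoubi.Kar D))
    (λ KK → IsDaggerKernelMap DK KK (Karoubi.I D))
proposition2p1 D DK = karDK , embedding-is-map
  where
    open IsDaggerKernelCategory DK
    open KaroubiKernels D
    module KerOf {A B} (f : Karoubi.KHom D A B) =
      KernelFromD zeroObj f (Kernel.k (kernel (Karoubi.KHom.map f)))
        (Kernel.isKernel (kernel (Karoubi.KHom.map f)))
        (kernel-dagger-mono (Karoubi.KHom.map f))

    karDK : IsDaggerKernelCategory (Karoubi.Kar D)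
    karDK = record
      { zeroObj = karoubi-zero zeroObj
      ; kernel = λ f → record { K = KerOf.kernelObj f ; k = KerOf.kernelMap f ; isKernel = KerOf.isKernel f }
      ; kernel-dagger-mono = KerOf.kernelMap-dagger-mono
      }

    embedding-is-map : IsDaggerKernelMap DK karDK (Karoubi.I D)
    embedding-is-map = record
      { preserves-† = λ _ → Category.Eq.refl (DaggerCategory.cat D)
      ; preserves-zero = embedding-preserves-zero (ZeroObject.isZero zeroObj)
      ; preserves-kernel = embedding-preserves-kernel zeroObj
      }
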